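{- Let $\mathbb{K}$ be a commutative ring, $F=\mathbb{K}\{x_1,\dots,x_m\}$, $n\ge1$ and $\delta\in\mathbb{N}^m$ with $\sum_i\delta_i\le n$. Then $\ker\sigma_n\cap\mathfrak{F}_\delta=\{0\}$ and $\sigma_n$ restricts to an isomorphism $\mathfrak{F}_\delta\cong TS^n_{\mathbb{K}}(F)_\delta$.
   Context: For a word $\upsilon$ in $x_1,\dots,x_m$, $\partial(\upsilon)\in\mathbb{N}^m$ is its multidegree ($i$-th entry = degree in $x_i$). $\Upsilon^+$ = set of positive-length words; $\alpha$ ranges over finitely supported $\alpha:\Upsilon^+\to\mathbb{N}$, $|\alpha|=\sum_\upsilon\alpha(\upsilon)$. $e^n_\alpha\in TS^n_{\mathbb{K}}(F)=(F^{\otimes n})^{S_n}$ is the coefficient of $\prod_\upsilon t_\upsilon^{\alpha(\upsilon)}$ in $(1\otimes1+\sum_{\upsilon}t_\upsilon\otimes\upsilon)^{\otimes n}$ (commuting indeterminates $t_\upsilon$). $\mathfrak{F}$ is the free $\mathbb{K}$-module with basis $f_\alpha$, $\sigma_n:\mathfrak{F}\to TS^n_{\mathbb{K}}(F)$ the $\mathbb{K}$-linear map $f_\alpha\mapsto e^n_\alpha$ if $|\alpha|\le n$, $f_\alpha\mapsto0$ otherwise; $\mathfrak{F}$ has the unique associative unital algebra structure making all $\sigma_n$ algebra homomorphisms. Multidegrees: $\partial(f_\alpha)=\sum_\upsilon\alpha(\upsilon)\partial(\upsilon)$, $\mathfrak{F}_\delta$ = span of $f_\alpha$ of multidegree $\delta$;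 $F^{\otimes n}$ is graded by $\partial(\upsilon_1\otimes\cdots\otimes\upsilon_n)=\sum_j\partial(\upsilon_j)$ and $TS^n_{\mathbb{K}}(F)_\delta$ is the span of the symmetric tensors of multidegree $\delta$. -}

module Defs where

open import Level using (Level)
open import Algebra.Bundles using (CommutativeRing)
open import Data.Nat as ℕ using (ℕ; _≤?_)
open import Data.Fin as Fin using (Fin)
open import Data.Fin.Permutation using (Permutation′; _⟨$⟩ʳ_)
open import Data.List as List using (List; []; _∷_; _++_; length; filter; foldr)
open import Data.List.NonEmpty as List⁺ using (List⁺)
open import Data.List.Properties using (≡-dec)
open import Data.List.Relation.Unary.All using (All; all?)
open import Data.Maybe using (Maybe; just; nothing)
open import Data.Product using (_×_; _,_)
open import Data.Vec as Vec using (Vec)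
open import Relation.Binary.PropositionalEquality using (_≡_; _≢_)
open import Relation.Nullary using (Dec; does)
open import Data.Bool using (if_then_else_)

-- Setting: K a commutative ring, F = K{x_1,…,x_m} the free associative algebra,
-- which as a K-module is free on the words in the letters Fin m.
module Setup {c ℓ : Level} (K : CommutativeRing c ℓ) (m : ℕ) where

  open CommutativeRing K

  Word : Set
  Word = List (Fin m)

  Word⁺ : Set
  Word⁺ = List⁺ (Fin m)

  _≟W_ : (u v : Word) → Dec (u ≡ v)
  _≟W_ = ≡-dec Fin._≟_

  Multideg : Set
  Multideg = Vec ℕ m

  _⊕_ : Multideg → Multideg → Multideg
  _⊕_ = Vec.zipWith ℕ._+_

  0ᵈ : Multideg
  0ᵈ = Vec.replicate m 0

  ∂w : Word → Multideg
  ∂w u = Vec.tabulate (λ i → length (filter (λ j → i Fin.≟ j) u))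

  -- α : Υ⁺ → ℕ finitely supported, represented as a finite multiset of
  -- positive words (a list, considered up to reordering; see _≈ₘ_).
  Index : Set
  Index = List Word⁺

  mult : Word⁺ → Index → ℕ
  mult υ α = length (filter (λ u → List⁺.toList u ≟W List⁺.toList υ) α)

  -- equality of multisets: α(υ) = β(υ) for every υ (it suffices to test the
  -- υ occurring in α or β, all other multiplicities being 0)
  _≈ₘ_ : Index → Index → Set
  α ≈ₘ β = All (λ υ → mult υ α ≡ mult υ β) (α ++ β)

  _≈ₘ?_ : (α β : Index) → Dec (α ≈ₘ β)
  α ≈ₘ? β = all? (λ υ → mult υ α ℕ.≟ mult υ β) (α ++ β)

  ∣_∣ : Index → ℕ
  ∣ α ∣ = length α

  ∂F : Index → Multideg
  ∂F α = foldr (λ υ d → ∂w (List⁺.toList υ) ⊕ d) 0ᵈ α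

  -- 𝔉 : free K-module with basis f_α; an element is a finite formal
  -- K-linear combination Σ c_k f_{α_k}.
  𝔉 : Set c
  𝔉 = List (Carrier × Index)

  coeff : 𝔉 → Index → Carrier
  coeff x β = foldr (λ { (a , α) r → (if does (α ≈ₘ? β) then a else 0#) + r }) 0# x

  In𝔉 : Multideg → 𝔉 → Set ℓ
  In𝔉 δ x = ∀ β → ∂F β ≢ δ → coeff x β ≈ 0#

  Is0𝔉 : 𝔉 → Set ℓ
  Is0𝔉 x = ∀ β → coeff x β ≈ 0#

  -- F^{⊗n} is the free K-module on n-tuples of words; an element is
  -- given by its coefficient function.
  Tensor : ℕ → Set c
  Tensor n = Vec Word n → Carrier

  ∂T : ∀ {n} → Vec Word n → Multideg
  ∂T w = Vec.foldr _ _⊕_ 0ᵈ (Vec.map ∂w w)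

  permute : ∀ {n} → Permutation′ n → Vec Word n → Vec Word n
  permute π w = Vec.tabulate (λ i → Vec.lookup w (π ⟨$⟩ʳ i))

  InTS : (n : ℕ) → Multideg → Tensor n → Set ℓ
  InTS n δ t =
    (∀ (π : Permutation′ n) (w : Vec Word n) → t (permute π w) ≈ t w)
    × (∀ (w : Vec Word n) → ∂T w ≢ δ → t w ≈ 0#)

  -- e^n_α: coefficient of ∏ t_υ^{α(υ)} in (1⊗1 + Σ_υ t_υ ⊗ υ)^{⊗n}.
  -- Expanding the product, a pure tensor υ_1⊗…⊗υ_n (υ_j possibly empty)
  -- arises from exactly one choice of summands (1⊗1 in position j iff υ_j
  -- is empty, t_{υ_j}⊗υ_j otherwise), with t-monomial ∏_{υ_j ≠ 1} t_{υ_j}.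
  -- Hence its coefficient in e^n_α is 1 if the multiset of nonempty
  -- entries equals α, and 0 otherwise.
  nonempty : ∀ {n} → Vec Word n → Index
  nonempty Vec.[] = []
  nonempty (u Vec.∷ w) with List⁺.fromList u
  ... | just υ  = υ ∷ nonempty w
  ... | nothing = nonempty w

  e : (n : ℕ) → Index → Tensor n
  e n α w = if does (nonempty w ≈ₘ? α) then 1# else 0#

  σ : (n : ℕ) → 𝔉 → Tensor n
  σ n x w = foldr (λ { (a , α) r →
              (if does (∣ α ∣ ≤? n) then a * e n α w else 0#) + r }) 0# x

{-# OPTIONS --safe #-}
-- Evaluating σ_n x at a pure tensor w = w_1 ⊗ … ⊗ w_n gives the coefficient of x at
-- the multiset of nonempty entries of w, so σ_n x is determined by coefficients of x
-- at multisets of size ≤ n. A multiset β of multidegree δ has |β| ≤ |δ| ≤ n, so it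
-- occurs as the nonempty part of the vector obtained by padding β with empty words:
-- this gives injectivity on 𝔉_δ. Conversely, two vectors of words with the same
-- multiset of nonempty entries are rearrangements of each other (both rearrange to
-- the padded form), so a symmetric tensor is a function of that multiset; choosing
-- one vector per multiset among the finitely many vectors of total degree |δ| gives
-- a preimage in 𝔉_δ.
module Submission where

open import Defs
open import Level using (Level)
open import Algebra.Bundles using (CommutativeRing)
open import Data.Nat using (ℕ; _≤_)
open import Data.Vec using (Vec; sum)
open import Data.Product using (_×_; ∃)

open import Data.Bool using (true; false; if_then_else_)
open import Data.Fin using (Fin; zero; suc)
import Data.Fin as Fin
open import Data.Fin.Patterns using (0F; 1F)
open import Data.Fin.Permutation using (Permutation′; _⟨$⟩ʳ_; lift₀; transpose)
import Data.List as List
open import Data.List using (List; []; _∷_; _++_; [_]; length; filter; cartesianProductWith; allFin; deduplicate)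
open import Data.List.Membership.Propositional using (_∈_; find)
open import Data.List.Membership.Propositional.Properties
  using (∈-cartesianProductWith⁺; ∈-allFin; ∈-∃++; ∈-++⁺ˡ; ∈-++⁺ʳ)
open import Data.List.NonEmpty using (toList) renaming (_∷_ to _∷⁺_)
open import Data.List.Properties using (filter-accept; filter-reject)
open import Data.List.Relation.Binary.Permutation.Propositional
  using (_↭_; prep; swap; ↭-refl; ↭-sym; ↭-trans; ↭-isEquivalence)
import Data.List.Relation.Binary.Permutation.Propositional as ↭
open import Data.List.Relation.Binary.Permutation.Propositional.Properties using (↭-length; filter-↭; shift)
open import Data.List.Relation.Unary.All as All using (All; []; _∷_)
open import Data.List.Relation.Unary.All.Properties using (¬Any⇒All¬)
open import Data.List.Relation.Unary.AllPairs using (_∷_)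
open import Data.List.Relation.Unary.Any as Any using (here; there; any?)
open import Data.List.Relation.Unary.Any.Properties using (deduplicate⁺; deduplicate⁻)
open import Data.List.Relation.Unary.Unique.DecSetoid.Properties using (deduplicate-!)
open import Data.List.Relation.Unary.Unique.Setoid using (Unique)
open import Data.Nat using (zero; suc; _+_; z≤n; s≤s; _≤?_)
open import Data.Nat.Properties using (+-commutativeSemigroup; +-0-commutativeMonoid)
import Data.Nat.Properties as ℕ
open import Algebra.Properties.CommutativeMonoid.Sum +-0-commutativeMonoid
  using (sum-syntax; sum-cong-≗; sum-replicate-zero; ∑-distrib-+; sum-permute)
open import Algebra.Properties.CommutativeSemigroup +-commutativeSemigroup using (interchange; x∙yz≈y∙xz)
open import Data.Product using (_,_)
open import Data.Vec using (tabulate; lookup; zipWith) renaming ([] to []ᵛ; _∷_ to _∷ᵛ_)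
open import Data.Vec.Functional.Relation.Binary.Permutation using () renaming (_↭_ to _↭ᶠ_)
import Data.Vec.Functional.Relation.Binary.Permutation.Properties as ↭ᶠ
open import Data.Vec.Properties
  using (≡-dec; tabulate-cong; tabulate∘lookup; lookup∘tabulate; tabulate-allFin; map-const; zipWith-identityˡ)
open import Function using (_∘_)
open import Function.Bundles using (mk⇔)
open import Relation.Binary.Bundles using (DecSetoid)
import Relation.Binary.Construct.On as On
open import Relation.Binary.PropositionalEquality
  using (_≡_; _≢_; refl; sym; trans; cong; cong₂; subst; module ≡-Reasoning)
import Relation.Binary.Reasoning.Setoid as SetoidReasoning
open import Relation.Nullary using (Dec; yes; no; does; ¬_)
open import Relation.Nullary.Decidable using (map′; dec-true; dec-false; does-⇔)
open import Relation.Nullary.Negation using (contradiction)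

𝟙 : ∀ {p} {P : Set p} → Dec P → ℕ
𝟙 P? = if does P? then 1 else 0

sum-zipWith-+ : ∀ {k} (a b : Vec ℕ k) → sum (zipWith _+_ a b) ≡ sum a + sum b
sum-zipWith-+ []ᵛ       []ᵛ       = refl
sum-zipWith-+ (x ∷ᵛ a) (y ∷ᵛ b) =
  trans (cong (x + y +_) (sum-zipWith-+ a b)) (interchange x y (sum a) (sum b))

zipWith-+-swap : ∀ {k} (a b c : Vec ℕ k) →
                 zipWith _+_ a (zipWith _+_ b c) ≡ zipWith _+_ b (zipWith _+_ a c)
zipWith-+-swap []ᵛ       []ᵛ       []ᵛ       = refl
zipWith-+-swap (x ∷ᵛ a) (y ∷ᵛ b) (z ∷ᵛ c) =
  cong₂ _∷ᵛ_ (x∙yz≈y∙xz x y z) (zipWith-+-swap a b c)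

sum-tabulate : ∀ {k} (f : Fin k → ℕ) → sum (tabulate f) ≡ ∑[ i < k ] f i
sum-tabulate {zero}  f = refl
sum-tabulate {suc k} f = cong (f zero +_) (sum-tabulate (f ∘ suc))

sum-𝟙-≟ : ∀ {k} (a : Fin k) → ∑[ i < k ] 𝟙 (i Fin.≟ a) ≡ 1
sum-𝟙-≟ {suc k} zero    = cong suc (sum-replicate-zero k)
sum-𝟙-≟ {suc k} (suc a) = sum-𝟙-≟ a

count : ∀ {k} → Fin k → List (Fin k) → ℕ
count i u = length (filter (i Fin.≟_) u)

count-∷ : ∀ {k} (i a : Fin k) u → count i (a ∷ u) ≡ 𝟙 (i Fin.≟ a) + count i u
count-∷ i a u with does (i Fin.≟ a)
... | true  = refl
... | false = refl

sum-counts : ∀ {k} (u : List (Fin k)) → sum (tabulate (λ i → count i u)) ≡ length u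
sum-counts {k} []      = trans (sum-tabulate {k} (λ _ → 0)) (sum-replicate-zero k)
sum-counts {k} (a ∷ u) = begin
  sum (tabulate (λ i → count i (a ∷ u)))            ≡⟨ sum-tabulate (λ i → count i (a ∷ u)) ⟩
  ∑[ i < k ] count i (a ∷ u)                        ≡⟨ sum-cong-≗ (λ i → count-∷ i a u) ⟩
  ∑[ i < k ] (𝟙 (i Fin.≟ a) + count i u)            ≡⟨ ∑-distrib-+ (λ i → 𝟙 (i Fin.≟ a)) (λ i → count i u) ⟩
  ∑[ i < k ] 𝟙 (i Fin.≟ a) + ∑[ i < k ] count i u   ≡⟨ cong (_+ _) (sum-𝟙-≟ a) ⟩
  suc (∑[ i < k ] count i u)                        ≡⟨ cong suc (sum-tabulate (λ i → count i u)) ⟨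
  suc (sum (tabulate (λ i → count i u)))            ≡⟨ cong suc (sum-counts u) ⟩
  suc (length u)                                    ∎
  where open ≡-Reasoning

module _ {a} {A : Set a} where

  infix 3 _↭ᵛ_

  -- A record rather than a function into Set, so that the vectors can be inferred.
  record _↭ᵛ_ {k} (v w : Vec A k) : Set a where
    constructor mk↭ᵛ
    field lookup-↭ : lookup v ↭ᶠ lookup w

  ↭ᵛ-refl : ∀ {k} {v : Vec A k} → v ↭ᵛ v
  ↭ᵛ-refl = mk↭ᵛ ↭ᶠ.↭-refl

  ↭ᵛ-sym : ∀ {k} {v w : Vec A k} → v ↭ᵛ w → w ↭ᵛ v
  ↭ᵛ-sym {k} {v} (mk↭ᵛ v↭w) = mk↭ᵛ (↭ᶠ.↭-sym {_} {_} {k} {k} {lookup v} v↭w)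

  ↭ᵛ-trans : ∀ {k} {u v w : Vec A k} → u ↭ᵛ v → v ↭ᵛ w → u ↭ᵛ w
  ↭ᵛ-trans {k} {u} (mk↭ᵛ u↭v) (mk↭ᵛ v↭w) =
    mk↭ᵛ (↭ᶠ.↭-trans {_} {_} {k} {k} {k} {lookup u} u↭v v↭w)

  ↭ᵛ-prep : ∀ {k} x {v w : Vec A k} → v ↭ᵛ w → x ∷ᵛ v ↭ᵛ x ∷ᵛ w
  ↭ᵛ-prep x (mk↭ᵛ (ρ , ρv≡w)) = mk↭ᵛ (lift₀ ρ , λ { zero → refl ; (suc i) → ρv≡w i })

  ↭ᵛ-swap : ∀ {k} x y (v : Vec A k) → x ∷ᵛ y ∷ᵛ v ↭ᵛ y ∷ᵛ x ∷ᵛ v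
  ↭ᵛ-swap x y v = mk↭ᵛ (transpose 0F 1F , λ { zero → refl ; (suc zero) → refl ; (suc (suc i)) → refl })

  vectorsOver : (k : ℕ) → List A → List (Vec A k)
  vectorsOver zero    xs = [ []ᵛ ]
  vectorsOver (suc k) xs = cartesianProductWith _∷ᵛ_ xs (vectorsOver k xs)

wordsUpTo : ∀ {k} → ℕ → List (List (Fin k))
wordsUpTo     zero    = [ [] ]
wordsUpTo {k} (suc L) = [] ∷ cartesianProductWith _∷_ (allFin k) (wordsUpTo L)

∈-wordsUpTo : ∀ {k L} (u : List (Fin k)) → length u ≤ L → u ∈ wordsUpTo L
∈-wordsUpTo {L = zero}  []      _           = here refl
∈-wordsUpTo {L = suc L} []      _           = here refl
∈-wordsUpTo {L = suc L} (a ∷ u) (s≤s |u|≤L) =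
  there (∈-cartesianProductWith⁺ _∷_ (∈-allFin a) (∈-wordsUpTo u |u|≤L))

module _ {c ℓ : Level} (K : CommutativeRing c ℓ) (m : ℕ) where

  open Setup K m

  toList-injective : ∀ {υ υ′ : Word⁺} → toList υ ≡ toList υ′ → υ ≡ υ′
  toList-injective {_ ∷⁺ _} {_ ∷⁺ _} refl = refl

  mult-∷ : ∀ υ υ′ α → mult υ (υ′ ∷ α) ≡ 𝟙 (toList υ′ ≟W toList υ) + mult υ α
  mult-∷ υ υ′ α with does (toList υ′ ≟W toList υ)
  ... | true  = refl
  ... | false = refl

  mult-here : ∀ υ α → mult υ (υ ∷ α) ≡ suc (mult υ α)
  mult-here υ α = cong length (filter-accept (λ u → toList u ≟W toList υ) refl)

  mult≢0⇒∈ : ∀ {υ} α → mult υ α ≢ 0 → υ ∈ α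
  mult≢0⇒∈     []       ≢0 = contradiction refl ≢0
  mult≢0⇒∈ {υ} (υ′ ∷ α) ≢0 with toList υ′ ≟W toList υ
  ... | yes υ′≡υ = here (toList-injective (sym υ′≡υ))
  ... | no  υ′≢υ =
    there (mult≢0⇒∈ α (≢0 ∘ trans (cong length (filter-reject (λ u → toList u ≟W toList υ) υ′≢υ))))

  mult-↭ : ∀ {α β} → α ↭ β → ∀ υ → mult υ α ≡ mult υ β
  mult-↭ α↭β υ = ↭-length (filter-↭ (λ u → toList u ≟W toList υ) α↭β)

  mult≡⇒↭ : ∀ α β → (∀ υ → mult υ α ≡ mult υ β) → α ↭ β
  mult≡⇒↭ []      []      _  = ↭-refl
  mult≡⇒↭ []      (υ ∷ β) eq = contradiction (trans (eq υ) (mult-here υ β)) ℕ.0≢1+n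
  mult≡⇒↭ (υ ∷ α) β       eq
    with ∈-∃++ (mult≢0⇒∈ β (ℕ.1+n≢0 ∘ trans (sym (mult-here υ α)) ∘ trans (eq υ)))
  ... | ys , zs , refl = ↭-trans (prep υ (mult≡⇒↭ α (ys ++ zs) eq′)) (↭-sym (shift υ ys zs))
    where
    eq′ : ∀ υ′ → mult υ′ α ≡ mult υ′ (ys ++ zs)
    eq′ υ′ = ℕ.+-cancelˡ-≡ (𝟙 (toList υ ≟W toList υ′)) _ _ (begin
      𝟙 (toList υ ≟W toList υ′) + mult υ′ α          ≡⟨ mult-∷ υ′ υ α ⟨
      mult υ′ (υ ∷ α)                                ≡⟨ eq υ′ ⟩
      mult υ′ (ys ++ υ ∷ zs)                         ≡⟨ mult-↭ (shift υ ys zs) υ′ ⟩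
      mult υ′ (υ ∷ ys ++ zs)                         ≡⟨ mult-∷ υ′ υ (ys ++ zs) ⟩
      𝟙 (toList υ ≟W toList υ′) + mult υ′ (ys ++ zs) ∎)
      where open ≡-Reasoning

  ≈ₘ⇒↭ : ∀ {α β} → α ≈ₘ β → α ↭ β
  ≈ₘ⇒↭ {α} {β} α≈β = mult≡⇒↭ α β mult≡
    where
    mult≡ : ∀ υ → mult υ α ≡ mult υ β
    mult≡ υ with mult υ α ℕ.≟ 0 | mult υ β ℕ.≟ 0
    ... | yes α₀ | yes β₀ = trans α₀ (sym β₀)
    ... | no α≢0 | _      = All.lookup α≈β (∈-++⁺ˡ (mult≢0⇒∈ α α≢0))
    ... | yes _  | no β≢0 = All.lookup α≈β (∈-++⁺ʳ α (mult≢0⇒∈ β β≢0))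

  ↭⇒≈ₘ : ∀ {α β} → α ↭ β → α ≈ₘ β
  ↭⇒≈ₘ α↭β = All.tabulate (λ {υ} _ → mult-↭ α↭β υ)

  -- does (α ↭? β) is definitionally does (α ≈ₘ? β), the test used by coeff and e.
  _↭?_ : (α β : Index) → Dec (α ↭ β)
  α ↭? β = map′ ≈ₘ⇒↭ ↭⇒≈ₘ (α ≈ₘ? β)

  ↭-decSetoid : DecSetoid _ _
  ↭-decSetoid = record { isDecEquivalence = record { isEquivalence = ↭-isEquivalence ; _≟_ = _↭?_ } }

  _≟ᵈ_ : (d d′ : Multideg) → Dec (d ≡ d′)
  _≟ᵈ_ = ≡-dec ℕ._≟_

  ∂w-[] : ∂w [] ≡ 0ᵈ
  ∂w-[] = trans (tabulate-allFin (λ _ → 0)) (map-const _ 0)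

  sum-∂w-⊕ : ∀ u d → sum (∂w u ⊕ d) ≡ length u + sum d
  sum-∂w-⊕ u d = trans (sum-zipWith-+ (∂w u) d) (cong (_+ sum d) (sum-counts u))

  ∂F-↭ : ∀ {α β} → α ↭ β → ∂F α ≡ ∂F β
  ∂F-↭ ↭.refl                  = refl
  ∂F-↭ (prep υ α↭β)            = cong (∂w (toList υ) ⊕_) (∂F-↭ α↭β)
  ∂F-↭ (swap {ys = β} υ υ′ α↭β) =
    trans (cong (λ d → ∂w (toList υ) ⊕ (∂w (toList υ′) ⊕ d)) (∂F-↭ α↭β))
          (zipWith-+-swap (∂w (toList υ)) (∂w (toList υ′)) (∂F β))
  ∂F-↭ (↭.trans α↭β β↭γ)       = trans (∂F-↭ α↭β) (∂F-↭ β↭γ)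

  length≤sum-∂F : ∀ β → length β ≤ sum (∂F β)
  length≤sum-∂F []      = z≤n
  length≤sum-∂F (υ ∷ β) =
    subst (suc (length β) ≤_) (sym (sum-∂w-⊕ (toList υ) (∂F β)))
          (ℕ.+-mono-≤ (s≤s z≤n) (length≤sum-∂F β))

  ∂F-nonempty : ∀ {k} (w : Vec Word k) → ∂F (nonempty w) ≡ ∂T w
  ∂F-nonempty []ᵛ               = refl
  ∂F-nonempty ([] ∷ᵛ w)         = begin
    ∂F (nonempty w)   ≡⟨ ∂F-nonempty w ⟩
    ∂T w              ≡⟨ zipWith-identityˡ ℕ.+-identityˡ (∂T w) ⟨
    0ᵈ ⊕ ∂T w         ≡⟨ cong (_⊕ ∂T w) ∂w-[] ⟨
    ∂w [] ⊕ ∂T w      ∎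
    where open ≡-Reasoning
  ∂F-nonempty ((a ∷ as) ∷ᵛ w) = cong (∂w (a ∷ as) ⊕_) (∂F-nonempty w)

  ∈-vectorsOver-wordsUpTo : ∀ {k L} (w : Vec Word k) → sum (∂T w) ≤ L → w ∈ vectorsOver k (wordsUpTo L)
  ∈-vectorsOver-wordsUpTo         []ᵛ      _  = here refl
  ∈-vectorsOver-wordsUpTo {L = L} (u ∷ᵛ w) ≤L =
    ∈-cartesianProductWith⁺ _∷ᵛ_ (∈-wordsUpTo u (ℕ.≤-trans (ℕ.m≤m+n _ _) ≤L′))
                                 (∈-vectorsOver-wordsUpTo w (ℕ.≤-trans (ℕ.m≤n+m _ _) ≤L′))
    where
    ≤L′ : length u + sum (∂T w) ≤ L
    ≤L′ = subst (_≤ L) (sum-∂w-⊕ u (∂T w)) ≤L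

  length-nonempty≤ : ∀ {k} (w : Vec Word k) → length (nonempty w) ≤ k
  length-nonempty≤ []ᵛ            = z≤n
  length-nonempty≤ ([] ∷ᵛ w)      = ℕ.m≤n⇒m≤1+n (length-nonempty≤ w)
  length-nonempty≤ ((_ ∷ _) ∷ᵛ w) = s≤s (length-nonempty≤ w)

  pad : (k : ℕ) → Index → Vec Word k
  pad zero    _       = []ᵛ
  pad (suc k) []      = [] ∷ᵛ pad k []
  pad (suc k) (υ ∷ β) = toList υ ∷ᵛ pad k β

  nonempty-pad : ∀ {k} β → length β ≤ k → nonempty (pad k β) ≡ β
  nonempty-pad {zero}  []      _           = refl
  nonempty-pad {suc k} []      _           = nonempty-pad {k} [] z≤n
  nonempty-pad {suc k} (υ ∷ β) (s≤s |β|≤k) = cong (υ ∷_) (nonempty-pad β |β|≤k)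

  []∷pad : ∀ {k} β → length β ≤ k → [] ∷ᵛ pad k β ↭ᵛ pad (suc k) β
  []∷pad         []      _           = ↭ᵛ-refl
  []∷pad {suc k} (υ ∷ β) (s≤s |β|≤k) =
    ↭ᵛ-trans (↭ᵛ-swap [] (toList υ) (pad k β)) (↭ᵛ-prep (toList υ) ([]∷pad β |β|≤k))

  ↭ᵛ-pad-nonempty : ∀ {k} (w : Vec Word k) → w ↭ᵛ pad k (nonempty w)
  ↭ᵛ-pad-nonempty []ᵛ             = ↭ᵛ-refl
  ↭ᵛ-pad-nonempty ([] ∷ᵛ w)       =
    ↭ᵛ-trans (↭ᵛ-prep [] (↭ᵛ-pad-nonempty w)) ([]∷pad (nonempty w) (length-nonempty≤ w))
  ↭ᵛ-pad-nonempty ((a ∷ as) ∷ᵛ w) = ↭ᵛ-prep (a ∷ as) (↭ᵛ-pad-nonempty w)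

  pad-↭ : ∀ {k α β} → α ↭ β → length α ≤ k → pad k α ↭ᵛ pad k β
  pad-↭     ↭.refl            _                 = ↭ᵛ-refl
  pad-↭     (prep υ α↭β)      (s≤s |α|≤k)       = ↭ᵛ-prep (toList υ) (pad-↭ α↭β |α|≤k)
  pad-↭     (swap υ υ′ α↭β)   (s≤s (s≤s |α|≤k)) =
    ↭ᵛ-trans (↭ᵛ-swap (toList υ) (toList υ′) _)
             (↭ᵛ-prep (toList υ′) (↭ᵛ-prep (toList υ) (pad-↭ α↭β |α|≤k)))
  pad-↭ {k} (↭.trans α↭β β↭γ) |α|≤k             =
    ↭ᵛ-trans (pad-↭ α↭β |α|≤k) (pad-↭ β↭γ (subst (_≤ k) (↭-length α↭β) |α|≤k))

  nonempty-↭⇒↭ᵛ : ∀ {k} {v w : Vec Word k} → nonempty v ↭ nonempty w → v ↭ᵛ w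
  nonempty-↭⇒↭ᵛ {k} {v} {w} v↭w =
    ↭ᵛ-trans (↭ᵛ-pad-nonempty v)
             (↭ᵛ-trans (pad-↭ v↭w (length-nonempty≤ v)) (↭ᵛ-sym (↭ᵛ-pad-nonempty w)))

  mult-nonempty : ∀ {k} υ (w : Vec Word k) →
                  mult υ (nonempty w) ≡ ∑[ i < k ] 𝟙 (lookup w i ≟W toList υ)
  mult-nonempty υ []ᵛ             = refl
  mult-nonempty υ ([] ∷ᵛ w)       = mult-nonempty υ w
  mult-nonempty υ ((a ∷ as) ∷ᵛ w) =
    trans (mult-∷ υ (a ∷⁺ as) (nonempty w)) (cong (𝟙 ((a ∷ as) ≟W toList υ) +_) (mult-nonempty υ w))

  nonempty-permute : ∀ {k} (π : Permutation′ k) (w : Vec Word k) → nonempty (permute π w) ↭ nonempty w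
  nonempty-permute {k} π w = mult≡⇒↭ _ _ λ υ → begin
    mult υ (nonempty (permute π w))                    ≡⟨ mult-nonempty υ (permute π w) ⟩
    ∑[ i < k ] 𝟙 (lookup (permute π w) i ≟W toList υ)
      ≡⟨ sum-cong-≗ (λ i → cong (λ u → 𝟙 (u ≟W toList υ)) (lookup∘tabulate (λ j → lookup w (π ⟨$⟩ʳ j)) i)) ⟩
    ∑[ i < k ] 𝟙 (lookup w (π ⟨$⟩ʳ i) ≟W toList υ)   ≡⟨ sum-permute (λ i → 𝟙 (lookup w i ≟W toList υ)) π ⟨
    ∑[ i < k ] 𝟙 (lookup w i ≟W toList υ)             ≡⟨ mult-nonempty υ w ⟨
    mult υ (nonempty w)                                ∎
    where open ≡-Reasoning

  nonempty-↭-decSetoid : ℕ → DecSetoid _ _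
  nonempty-↭-decSetoid k = On.decSetoid ↭-decSetoid (nonempty {k})

  representatives : ∀ {k} → List (Vec Word k) → List (Vec Word k)
  representatives = deduplicate (λ u v → nonempty u ↭? nonempty v)

  open CommutativeRing K
    using (Carrier; _≈_; 0#; 1#; _*_; +-cong; +-identityˡ; +-identityʳ; *-identityʳ; zeroʳ)
    renaming (refl to ≈-refl; sym to ≈-sym; trans to ≈-trans; reflexive to ≈-reflexive; setoid to K-setoid)

  if-yes : ∀ {p} {P : Set p} (P? : Dec P) {a : Carrier} → P → (if does P? then a else 0#) ≡ a
  if-yes P? {a} p = cong (if_then a else 0#) (dec-true P? p)

  if-no : ∀ {p} {P : Set p} (P? : Dec P) {a : Carrier} → ¬ P → (if does P? then a else 0#) ≡ 0#
  if-no P? {a} ¬p = cong (if_then a else 0#) (dec-false P? ¬p)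

  IsSymmetric : ∀ {k} → Tensor k → Set ℓ
  IsSymmetric t = ∀ π w → t (permute π w) ≈ t w

  symmetric-resp-↭ᵛ : ∀ {k} {t : Tensor k} → IsSymmetric t → ∀ {v w} → v ↭ᵛ w → t v ≈ t w
  symmetric-resp-↭ᵛ {t = t} t-sym {v} {w} (mk↭ᵛ (ρ , ρv≡w)) = begin
    t v                ≈⟨ t-sym ρ v ⟨
    t (permute ρ v)    ≡⟨ cong t (trans (tabulate-cong ρv≡w) (tabulate∘lookup w)) ⟩
    t w                ∎
    where open SetoidReasoning K-setoid

  coeff-↭ : ∀ x {β γ} → β ↭ γ → coeff x β ≈ coeff x γ
  coeff-↭ []                    _   = ≈-refl
  coeff-↭ ((a , α) ∷ x) {β} {γ} β↭γ =
    +-cong (≈-reflexive (cong (if_then a else 0#) (does-⇔ α↭β⇔α↭γ (α ↭? β) (α ↭? γ)))) (coeff-↭ x β↭γ)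
    where
    α↭β⇔α↭γ = mk⇔ (λ α↭β → ↭-trans α↭β β↭γ) (λ α↭γ → ↭-trans α↭γ (↭-sym β↭γ))

  coeff-nonempty-≈0 : ∀ {δ} x → In𝔉 δ x → ∀ {k} (w : Vec Word k) → ∂T w ≢ δ → coeff x (nonempty w) ≈ 0#
  coeff-nonempty-≈0 x x∈𝔉δ w ∂w≢δ = x∈𝔉δ (nonempty w) (∂w≢δ ∘ trans (sym (∂F-nonempty w)))

  -- The cut-off |α| ≤ n in σ is invisible here: α ↭ nonempty w forces |α| ≤ n.
  σ≈coeff-nonempty : ∀ n x (w : Vec Word n) → σ n x w ≈ coeff x (nonempty w)
  σ≈coeff-nonempty n []            w = ≈-refl
  σ≈coeff-nonempty n ((a , α) ∷ x) w = +-cong term (σ≈coeff-nonempty n x w)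
    where
    open SetoidReasoning K-setoid
    term : (if does (∣ α ∣ ≤? n) then a * e n α w else 0#) ≈ (if does (α ↭? nonempty w) then a else 0#)
    term with α ↭? nonempty w
    ... | yes α↭w = begin
      (if does (∣ α ∣ ≤? n) then a * e n α w else 0#)  ≡⟨ if-yes (∣ α ∣ ≤? n) |α|≤n ⟩
      a * e n α w                                       ≡⟨ cong (a *_) (if-yes (nonempty w ↭? α) (↭-sym α↭w)) ⟩
      a * 1#                                            ≈⟨ *-identityʳ a ⟩
      a                                                 ≡⟨ if-yes (α ↭? nonempty w) α↭w ⟨
      (if does (α ↭? nonempty w) then a else 0#)        ∎
      where
      |α|≤n : ∣ α ∣ ≤ n
      |α|≤n = subst (_≤ n) (sym (↭-length α↭w)) (length-nonempty≤ w)
    ... | no ¬α↭w = begin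
      (if does (∣ α ∣ ≤? n) then a * e n α w else 0#)  ≈⟨ a*e≈0 (does (∣ α ∣ ≤? n)) ⟩
      0#                                                ≡⟨ if-no (α ↭? nonempty w) ¬α↭w ⟨
      (if does (α ↭? nonempty w) then a else 0#)        ∎
      where
      a*e≈0 : ∀ b → (if b then a * e n α w else 0#) ≈ 0#
      a*e≈0 true  = ≈-trans (≈-reflexive (cong (a *_) (if-no (nonempty w ↭? α) (¬α↭w ∘ ↭-sym)))) (zeroʳ a)
      a*e≈0 false = ≈-refl

  combination : ∀ {k} → Tensor k → List (Vec Word k) → 𝔉
  combination t = List.map (λ v → t v , nonempty v)

  coeff-combination-∉ : ∀ {k} (t : Tensor k) {vs γ} → All (λ v → ¬ (nonempty v ↭ γ)) vs →
                        coeff (combination t vs) γ ≈ 0#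
  coeff-combination-∉ t         []             = ≈-refl
  coeff-combination-∉ t {v ∷ _} {γ} (¬v↭γ ∷ ¬vs↭γ) =
    ≈-trans (+-cong (≈-reflexive (if-no (nonempty v ↭? γ) ¬v↭γ)) (coeff-combination-∉ t ¬vs↭γ))
            (+-identityˡ 0#)

  coeff-combination-∈ : ∀ {k} (t : Tensor k) {vs v γ} →
                        Unique (DecSetoid.setoid (nonempty-↭-decSetoid k)) vs → v ∈ vs → nonempty v ↭ γ → coeff (combination t vs) γ ≈ t v
  coeff-combination-∈ t {v ∷ vs} {γ = γ} (v≉vs ∷ _) (here refl) v↭γ =
    ≈-trans (+-cong (≈-reflexive (if-yes (nonempty v ↭? γ) v↭γ))
                    (coeff-combination-∉ t (All.map (λ {u} → ¬↭γ {u}) v≉vs)))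
            (+-identityʳ (t v))
    where
    ¬↭γ : ∀ {u} → ¬ (nonempty v ↭ nonempty u) → ¬ (nonempty u ↭ γ)
    ¬↭γ v≉u u↭γ = v≉u (↭-trans v↭γ (↭-sym u↭γ))
  coeff-combination-∈ t {u ∷ vs} {v} {γ} (u≉vs ∷ vs-unique) (there v∈vs) v↭γ =
    ≈-trans (+-cong (≈-reflexive (if-no (nonempty u ↭? γ) ¬u↭γ)) (coeff-combination-∈ t vs-unique v∈vs v↭γ))
            (+-identityˡ (t v))
    where
    ¬u↭γ : ¬ (nonempty u ↭ γ)
    ¬u↭γ u↭γ = All.lookup u≉vs v∈vs (↭-trans u↭γ (↭-sym v↭γ))

  coeff-combination-representatives-≈0 : ∀ {k} (t : Tensor k) {γ} vs →
    (∀ {v} → v ∈ vs → nonempty v ↭ γ → t v ≈ 0#) → coeff (combination t (representatives vs)) γ ≈ 0#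
  coeff-combination-representatives-≈0 {k} t {γ} vs t≈0
    with any? (λ v → nonempty v ↭? γ) (representatives vs)
  ... | no ∄v = coeff-combination-∉ t (¬Any⇒All¬ _ ∄v)
  ... | yes ∃v with find ∃v
  ...   | v , v∈reps , v↭γ =
    ≈-trans (coeff-combination-∈ t (deduplicate-! (nonempty-↭-decSetoid k) vs) v∈reps v↭γ)
            (t≈0 (deduplicate⁻ _ v∈reps) v↭γ)

  coeff-combination-representatives-nonempty : ∀ {k} (t : Tensor k) → IsSymmetric t → ∀ {vs w} → w ∈ vs →
    coeff (combination t (representatives vs)) (nonempty w) ≈ t w
  coeff-combination-representatives-nonempty {k} t t-sym {vs} w∈vs
    with find (deduplicate⁺ _ ↭-trans (Any.map (λ { refl → ↭-refl }) w∈vs))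
  ... | v , v∈reps , v↭w =
    ≈-trans (coeff-combination-∈ t (deduplicate-! (nonempty-↭-decSetoid k) vs) v∈reps v↭w)
            (symmetric-resp-↭ᵛ t-sym (nonempty-↭⇒↭ᵛ v↭w))

  σ-symmetric : ∀ n x → IsSymmetric (σ n x)
  σ-symmetric n x π w = begin
    σ n x (permute π w)                ≈⟨ σ≈coeff-nonempty n x (permute π w) ⟩
    coeff x (nonempty (permute π w))   ≈⟨ coeff-↭ x (nonempty-permute π w) ⟩
    coeff x (nonempty w)               ≈⟨ σ≈coeff-nonempty n x w ⟨
    σ n x w                            ∎
    where open SetoidReasoning K-setoid

  σ-maps-𝔉-into-TS : ∀ n δ x → In𝔉 δ x → InTS n δ (σ n x)
  σ-maps-𝔉-into-TS n δ x x∈𝔉δ = σ-symmetric n x , σx-vanishes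
    where
    σx-vanishes : ∀ w → ∂T w ≢ δ → σ n x w ≈ 0#
    σx-vanishes w ∂w≢δ = ≈-trans (σ≈coeff-nonempty n x w) (coeff-nonempty-≈0 x x∈𝔉δ w ∂w≢δ)

  σ-injective-on-𝔉 : ∀ n δ → sum δ ≤ n → ∀ x → In𝔉 δ x → (∀ w → σ n x w ≈ 0#) → Is0𝔉 x
  σ-injective-on-𝔉 n δ ∑δ≤n x x∈𝔉δ σx≈0 β with ∂F β ≟ᵈ δ
  ... | no ∂β≢δ  = x∈𝔉δ β ∂β≢δ
  ... | yes ∂β≡δ = begin
    coeff x β                      ≡⟨ cong (coeff x) (nonempty-pad β |β|≤n) ⟨
    coeff x (nonempty (pad n β))   ≈⟨ σ≈coeff-nonempty n x (pad n β) ⟨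
    σ n x (pad n β)                ≈⟨ σx≈0 (pad n β) ⟩
    0#                             ∎
    where
    open SetoidReasoning K-setoid
    |β|≤n : length β ≤ n
    |β|≤n = ℕ.≤-trans (length≤sum-∂F β) (subst (_≤ n) (cong sum (sym ∂β≡δ)) ∑δ≤n)

  -- Summing t v f_{nonempty v} over all vectors v would multiply the coefficients by
  -- orbit sizes, which cannot be divided out over K; so one vector per orbit is kept.
  σ-surjective-onto-TS : ∀ n δ t → InTS n δ t → ∃ λ x → In𝔉 δ x × (∀ w → σ n x w ≈ t w)
  σ-surjective-onto-TS n δ t (t-sym , t-vanishes) = x , x∈𝔉δ , σx≈t
    where
    candidates : List (Vec Word n)
    candidates = vectorsOver n (wordsUpTo (sum δ))

    x : 𝔉
    x = combination t (representatives candidates)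

    x∈𝔉δ : In𝔉 δ x
    x∈𝔉δ γ ∂γ≢δ = coeff-combination-representatives-≈0 t candidates λ {v} _ v↭γ →
      t-vanishes v (λ ∂v≡δ → ∂γ≢δ (trans (sym (∂F-↭ v↭γ)) (trans (∂F-nonempty v) ∂v≡δ)))

    σx≈t : ∀ w → σ n x w ≈ t w
    σx≈t w = ≈-trans (σ≈coeff-nonempty n x w) (coeff≈t (∂T w ≟ᵈ δ))
      where
      coeff≈t : Dec (∂T w ≡ δ) → coeff x (nonempty w) ≈ t w
      coeff≈t (yes ∂w≡δ) = coeff-combination-representatives-nonempty t t-sym
        (∈-vectorsOver-wordsUpTo w (ℕ.≤-reflexive (cong sum ∂w≡δ)))
      coeff≈t (no ∂w≢δ)  = ≈-trans (coeff-nonempty-≈0 x x∈𝔉δ w ∂w≢δ) (≈-sym (t-vanishes w ∂w≢δ))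

mainTheorem11 : ∀ {c ℓ : Level} (K : CommutativeRing c ℓ) (m n : ℕ) → 1 ≤ n →
    (δ : Vec ℕ m) → sum δ ≤ n →
    let open CommutativeRing K
        open Setup K m
    in
    -- σ_n maps 𝔉_δ into TS^n_K(F)_δ
    (∀ (x : 𝔉) → In𝔉 δ x → InTS n δ (σ n x))
    -- ker σ_n ∩ 𝔉_δ = {0}
    × (∀ (x : 𝔉) → In𝔉 δ x → (∀ w → σ n x w ≈ 0#) → Is0𝔉 x)
    -- surjectivity onto TS^n_K(F)_δ
    × (∀ (t : Tensor n) → InTS n δ t →
         ∃ λ (x : 𝔉) → In𝔉 δ x × (∀ w → σ n x w ≈ t w))
mainTheorem11 K m n _ δ ∑δ≤n =
  σ-maps-𝔉-into-TS K m n δ , σ-injective-on-𝔉 K m n δ ∑δ≤n , σ-surjective-onto-TS K m n δ
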